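{- Let $\phi(X)$ be an MSO$_1$ formula with one free vertex-set variable, $G=(V,E,\mathcal{C})$ a colored graph, and $S,S'\subseteq V$ with $G\models\phi(S)$, $G\models\phi(S')$, $|S|=|S'|=k$, where $S$ and $S'$ are among the colors of $\mathcal{C}$. If feasible sets $R,R'\subseteq V$ have the same shape and the same size, then there is a $\mathsf{TJ}(\phi)$-sequence of length $|R\setminus R'|$ from $R$ to $R'$ such that all sets in the sequence have the same shape.
   Context: A colored graph is $G=(V,E,\mathcal{C})$ with $\mathcal{C}=\langle C_1,\dots,C_c\rangle$ a tuple of subsets of $V$ (colors); $\mathcal{C}(v)$ is the set of colors containing $v$. MSO$_1$ formulas use vertex and vertex-set variables, atomic formulas $x=y$, $E(x,y)$, $C_i(x)$, $X(x)$, Boolean connectives and quantification over vertices and vertex sets. A set $X\subseteq V$ is feasible if $G\models\phi(X)$. A $\mathsf{TJ}(\phi)$-sequence from $S_0$ to $S_\ell$ (of length $\ell$) is a sequence $S_0,\dots,S_\ell$ of vertex subsets with $|S_{i-1}\setminus S_i|=|S_i\setminus S_{i-1}|=1$ for $i\in[\ell]$ and $G\models\phi(S_i)$ for all $i$. For an MSO$_1$ formula $\psi$, $\mathsf{q}(\psi)=2^{q_s}\cdot q_v$ where $q_s$, $q_v$ are the numbers of set and vertex quantifiers in $\psi$. Two vertices $u,v$ have the same type if they are twins ($N(u)=N(v)$ or $N[u]=N[v]$) and $\mathcal{C}(u)=\mathcal{C}(v)$; let $V_1,\dots,V_t$ be the partition of $V$ into types. The signature of $X$ is $\sigma_X(i)=|V_i\cap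 X|$, $i\in[t]$. A shape is a map $\bar\sigma$ on $[t]$ with $\bar\sigma(i)\in[0,\mathsf{q}(\phi)-1]\cup\{\bot\}\cup[|V_i|-\mathsf{q}(\phi)+1,|V_i|]$. A set $X$ has shape $\bar\sigma$ if for every $i$, $\bar\sigma(i)=\bot$ when $\mathsf{q}(\phi)\le\sigma_X(i)\le|V_i|-\mathsf{q}(\phi)$, and $\bar\sigma(i)=\sigma_X(i)$ otherwise. -}

module Defs where

open import Data.Nat using (ℕ; zero; suc; _+_; _*_; _∸_; _^_; _≤_; _≤ᵇ_)
open import Data.Bool using (Bool; true; false; _∧_; _∨_; not; _xor_)
open import Data.Fin using (Fin; zero; suc; inject₁; fromℕ; _≟_)
open import Data.Fin.Subset using (Subset; _∈_; _∩_; _─_; ∣_∣)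
open import Data.Vec using (Vec; lookup; tabulate)
open import Data.Maybe using (Maybe; just; nothing)
open import Data.Product using (Σ; _×_; _,_)
open import Data.Sum using (_⊎_)
open import Data.Empty using (⊥)
open import Data.Unit using (⊤)
open import Relation.Nullary using (¬_)
open import Relation.Nullary.Decidable using (⌊_⌋)
open import Relation.Binary.PropositionalEquality using (_≡_)

record ColoredGraph (n c : ℕ) : Set where
  field
    E     : Fin n → Fin n → Bool
    E-sym : ∀ u v → E u v ≡ E v u
    E-irr : ∀ v → E v v ≡ false
    color : Fin c → Subset n
open ColoredGraph public

-- MSO_1 formulas over c colors with nv free vertex variables and
-- ns free vertex-set variables (de Bruijn indices).

data Formula (c : ℕ) : ℕ → ℕ → Set where
  _≐_   : ∀ {nv ns} → Fin nv → Fin nv → Formula c nv ns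
  edge  : ∀ {nv ns} → Fin nv → Fin nv → Formula c nv ns
  col   : ∀ {nv ns} → Fin c → Fin nv → Formula c nv ns
  mem   : ∀ {nv ns} → Fin ns → Fin nv → Formula c nv ns
  ¬'    : ∀ {nv ns} → Formula c nv ns → Formula c nv ns
  _∧'_  : ∀ {nv ns} → Formula c nv ns → Formula c nv ns → Formula c nv ns
  _∨'_  : ∀ {nv ns} → Formula c nv ns → Formula c nv ns → Formula c nv ns
  _⇒'_  : ∀ {nv ns} → Formula c nv ns → Formula c nv ns → Formula c nv ns
  ∃v ∀v : ∀ {nv ns} → Formula c (suc nv) ns → Formula c nv ns
  ∃s ∀s : ∀ {nv ns} → Formula c nv (suc ns) → Formula c nv ns

extend : ∀ {m} {A : Set} → A → (Fin m → A) → Fin (suc m) → A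
extend a ρ zero    = a
extend a ρ (suc i) = ρ i

⟦_⟧ : ∀ {n c nv ns} → Formula c nv ns → ColoredGraph n c →
      (Fin nv → Fin n) → (Fin ns → Subset n) → Set
⟦ x ≐ y ⟧   G ρv ρs = ρv x ≡ ρv y
⟦ edge x y ⟧ G ρv ρs = E G (ρv x) (ρv y) ≡ true
⟦ col i x ⟧  G ρv ρs = ρv x ∈ color G i
⟦ mem X x ⟧  G ρv ρs = ρv x ∈ ρs X
⟦ ¬' ψ ⟧     G ρv ρs = ¬ ⟦ ψ ⟧ G ρv ρs
⟦ ψ ∧' χ ⟧   G ρv ρs = ⟦ ψ ⟧ G ρv ρs × ⟦ χ ⟧ G ρv ρs
⟦ ψ ∨' χ ⟧   G ρv ρs = ⟦ ψ ⟧ G ρv ρs ⊎ ⟦ χ ⟧ G ρv ρs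
⟦ ψ ⇒' χ ⟧   G ρv ρs = ⟦ ψ ⟧ G ρv ρs → ⟦ χ ⟧ G ρv ρs
⟦_⟧ {n} (∃v ψ) G ρv ρs = Σ (Fin n) λ v → ⟦ ψ ⟧ G (extend v ρv) ρs
⟦_⟧ {n} (∀v ψ) G ρv ρs = ∀ (v : Fin n) → ⟦ ψ ⟧ G (extend v ρv) ρs
⟦_⟧ {n} (∃s ψ) G ρv ρs = Σ (Subset n) λ Y → ⟦ ψ ⟧ G ρv (extend Y ρs)
⟦_⟧ {n} (∀s ψ) G ρv ρs = ∀ (Y : Subset n) → ⟦ ψ ⟧ G ρv (extend Y ρs)

noVars : {A : Set} → Fin 0 → A
noVars ()

Feasible : ∀ {n c} → ColoredGraph n c → Formula c 0 1 → Subset n → Set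
Feasible G φ X = ⟦ φ ⟧ G noVars (λ _ → X)

qs qv : ∀ {c nv ns} → Formula c nv ns → ℕ
qs (_ ≐ _) = 0
qs (edge _ _) = 0
qs (col _ _) = 0
qs (mem _ _) = 0
qs (¬' ψ) = qs ψ
qs (ψ ∧' χ) = qs ψ + qs χ
qs (ψ ∨' χ) = qs ψ + qs χ
qs (ψ ⇒' χ) = qs ψ + qs χ
qs (∃v ψ) = qs ψ
qs (∀v ψ) = qs ψ
qs (∃s ψ) = suc (qs ψ)
qs (∀s ψ) = suc (qs ψ)
qv (_ ≐ _) = 0
qv (edge _ _) = 0
qv (col _ _) = 0
qv (mem _ _) = 0
qv (¬' ψ) = qv ψ
qv (ψ ∧' χ) = qv ψ + qv χ
qv (ψ ∨' χ) = qv ψ + qv χ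
qv (ψ ⇒' χ) = qv ψ + qv χ
qv (∃v ψ) = suc (qv ψ)
qv (∀v ψ) = suc (qv ψ)
qv (∃s ψ) = qv ψ
qv (∀s ψ) = qv ψ

q : ∀ {c nv ns} → Formula c nv ns → ℕ
q ψ = 2 ^ qs ψ * qv ψ

allB : ∀ {m} → (Fin m → Bool) → Bool
allB {zero}  f = true
allB {suc m} f = f zero ∧ allB (λ i → f (suc i))

_==_ : Bool → Bool → Bool
a == b = not (a xor b)

closedN : ∀ {n c} → ColoredGraph n c → Fin n → Fin n → Bool
closedN G u w = ⌊ u ≟ w ⌋ ∨ E G u w

sameType : ∀ {n c} → ColoredGraph n c → Fin n → Fin n → Bool
sameType G u v =
  (allB (λ w → E G u w == E G v w) ∨ allB (λ w → closedN G u w == closedN G v w))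
  ∧ allB (λ i → lookup (color G i) u == lookup (color G i) v)

typeClass : ∀ {n c} → ColoredGraph n c → Fin n → Subset n
typeClass G v = tabulate (sameType G v)

-- Shapes. For a type class T and parameter q, the shape value of X at T
-- is ⊥ (nothing) if q ≤ |T ∩ X| ≤ |T| - q, and |T ∩ X| otherwise.

shapeVal : ℕ → ℕ → ℕ → Maybe ℕ
shapeVal qq size m with (qq ≤ᵇ m) ∧ (m ≤ᵇ size ∸ qq)
... | true  = nothing
... | false = just m

shapeAt : ∀ {n} → ℕ → Subset n → Subset n → Maybe ℕ
shapeAt qq T X = shapeVal qq ∣ T ∣ ∣ T ∩ X ∣

-- X and Y have the same shape (w.r.t. q(φ)): equal shape value on every
-- type class (every class is the class of some vertex v).
SameShape : ∀ {n c} → ColoredGraph n c → ℕ → Subset n → Subset n → Set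
SameShape G qq X Y = ∀ v → shapeAt qq (typeClass G v) X ≡ shapeAt qq (typeClass G v) Y

record TJSeq {n c} (G : ColoredGraph n c) (φ : Formula c 0 1)
             (A B : Subset n) (ℓ : ℕ) : Set where
  field
    S        : Fin (suc ℓ) → Subset n
    start    : S zero ≡ A
    end      : S (fromℕ ℓ) ≡ B
    out      : ∀ (i : Fin ℓ) → ∣ S (inject₁ i) ─ S (suc i) ∣ ≡ 1
    inn      : ∀ (i : Fin ℓ) → ∣ S (suc i) ─ S (inject₁ i) ∣ ≡ 1
    feasible : ∀ i → Feasible G φ (S i)
open TJSeq public

-- Sets of the same shape satisfy the same MSO₁ formulas φ(X), by an Ehrenfeucht–Fraïssé argument.
-- Call the unpinned vertices of one type with the same memberships in the chosen sets a cell.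
-- Duplicator keeps the pinned vertices in correspondence and the sizes of corresponding cells
-- equal or both at least a threshold m; a vertex round costs one unit of m and a set round halves
-- it, so q(φ) = 2^{q_s}·q_v is enough to start with.
-- To walk from R to R', swap a vertex u ∈ C ∖ R' for a vertex w ∈ R' ∖ C, of the same type as u
-- whenever such a pair exists.  Otherwise every type class touched by the swap moves its count
-- monotonically towards that of R', so the shape, and with it feasibility, is kept.  Each swap
-- shrinks C ∖ R' by one, giving a sequence of length |R ∖ R'|.

module Submission where

open import Defs
open import Data.Nat
  using (ℕ; zero; suc; _+_; _*_; _^_; _∸_; _≤_; _⊓_; z≤n; s≤s; _<ᵇ_; _≤ᵇ_; _<?_) renaming (_≟_ to _≟ℕ_)
open import Data.Nat.Properties
  using (≤-refl; ≤-trans; ≤-antisym; <⇒≤; ≮⇒≥; n≤1+n; m≤m+n; m≤n+m; m≤m*n; m∸n≤m; ∸-mono; ∸-monoˡ-≤;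
         m+n∸n≡m; m+n∸m≡n; m∸[m∸n]≡n; +-∸-comm; m+n≤o⇒m≤o∸n; m≤o∸n⇒m+n≤o; m≤n⇒m⊓n≡m; suc-injective;
         +-comm; +-identityʳ; +-cancelˡ-≡; *-mono-≤; *-suc; *-assoc; ^-monoʳ-≤; m^n>0; ≤ᵇ⇒≤; ≤⇒≤ᵇ;
         +-commutativeSemigroup; module ≤-Reasoning)
open import Algebra.Properties.CommutativeSemigroup +-commutativeSemigroup using (interchange; x∙yz≈y∙xz)
open import Data.Bool using (Bool; true; false; _∧_; _∨_; not)
open import Data.Bool.Properties
  using (∧-comm; ∧-assoc; ∧-identityʳ; ∧-zeroʳ; ∧-inverseʳ; ∧-conicalˡ; ∧-conicalʳ; ∨-identityʳ; ∨-zeroʳ;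
         not-injective; T-≡)
open import Data.Fin using (Fin; zero; suc; _≟_; inject₁)
open import Data.Fin.Subset using (Subset; _∩_; _─_; ∣_∣)
open import Data.Vec using ([]; _∷_; lookup; tabulate)
open import Data.Vec.Properties
  using (lookup∘tabulate; tabulate∘lookup; tabulate-cong; lookup-zipWith; []=⇒lookup; lookup⇒[]=)
open import Data.Maybe using (Maybe; just; nothing)
open import Data.Maybe.Properties using (just-injective)
open import Data.Product using (Σ; _×_; _,_; proj₁; proj₂)
open import Data.Sum using (_⊎_; inj₁; inj₂)
open import Data.Empty using (⊥; ⊥-elim)
open import Function using (_∘_; Equivalence)
open import Relation.Nullary using (yes; no)
open import Relation.Nullary.Decidable using (⌊_⌋)
open import Relation.Binary.PropositionalEquality

private
  variable
    n : ℕ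

true≢false : true ≢ false
true≢false ()

∨-true : ∀ a b → a ∨ b ≡ true → a ≡ true ⊎ b ≡ true
∨-true true  _ _ = inj₁ refl
∨-true false _ e = inj₂ e

==⇒≡ : ∀ a b → (a == b) ≡ true → a ≡ b
==⇒≡ true  true  _ = refl
==⇒≡ false false _ = refl

≡⇒== : ∀ {a b} → a ≡ b → (a == b) ≡ true
≡⇒== {true}  refl = refl
≡⇒== {false} refl = refl

true==b : ∀ b → (true == b) ≡ b
true==b true  = refl
true==b false = refl

false==b : ∀ b → (false == b) ≡ not b
false==b true  = refl
false==b false = refl

≡-fromImplications : ∀ {a b} → (a ≡ true → b ≡ true) → (b ≡ true → a ≡ true) → a ≡ b
≡-fromImplications {true}  {true}  _ _ = refl
≡-fromImplications {false} {false} _ _ = refl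
≡-fromImplications {true}  {false} f _ = sym (f refl)
≡-fromImplications {false} {true}  _ g = g refl

allB⇒ : (f : Fin n → Bool) → allB f ≡ true → ∀ i → f i ≡ true
allB⇒ f e zero    with f zero in eq
... | true = refl
allB⇒ f e (suc i) with f zero
... | true = allB⇒ (λ j → f (suc j)) e i

⇒allB : (f : Fin n → Bool) → (∀ i → f i ≡ true) → allB f ≡ true
⇒allB {zero}  f h = refl
⇒allB {suc n} f h rewrite h zero = ⇒allB (λ j → f (suc j)) (λ j → h (suc j))

allB-cong : (f g : Fin n → Bool) → (∀ i → f i ≡ g i) → allB f ≡ allB g
allB-cong {zero}  f g e = refl
allB-cong {suc n} f g e = cong₂ _∧_ (e zero) (allB-cong _ _ (λ i → e (suc i)))

anyB : (Fin n → Bool) → Bool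
anyB {zero}  f = false
anyB {suc n} f = f zero ∨ anyB (λ i → f (suc i))

anyB⇒ : (f : Fin n → Bool) → anyB f ≡ true → Σ (Fin n) (λ i → f i ≡ true)
anyB⇒ {suc n} f e with f zero in eq
... | true  = zero , eq
... | false with anyB⇒ (λ i → f (suc i)) e
...   | i , p = suc i , p

⇒anyB : (f : Fin n → Bool) (i : Fin n) → f i ≡ true → anyB f ≡ true
⇒anyB f zero    p rewrite p = refl
⇒anyB f (suc i) p with f zero
... | true  = refl
... | false = ⇒anyB (λ j → f (suc j)) i p

anyB-false : (f : Fin n → Bool) → anyB f ≡ false → ∀ i → f i ≡ false
anyB-false f e i with f i in eq
... | false = refl
... | true  = trans (sym (⇒anyB f i eq)) e

false-anyB : (f : Fin n → Bool) → (∀ i → f i ≡ false) → anyB f ≡ false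
false-anyB {zero}  f h = refl
false-anyB {suc n} f h rewrite h zero = false-anyB (λ i → f (suc i)) (λ i → h (suc i))

_==ᶠ_ : Fin n → Fin n → Bool
u ==ᶠ v = ⌊ u ≟ v ⌋

==ᶠ-refl : (u : Fin n) → (u ==ᶠ u) ≡ true
==ᶠ-refl u with u ≟ u
... | yes _  = refl
... | no u≢u = ⊥-elim (u≢u refl)

==ᶠ-≢ : {u v : Fin n} → u ≢ v → (u ==ᶠ v) ≡ false
==ᶠ-≢ {u = u} {v} u≢v with u ≟ v
... | yes u≡v = ⊥-elim (u≢v u≡v)
... | no _    = refl

==ᶠ⇒≡ : (u v : Fin n) → (u ==ᶠ v) ≡ true → u ≡ v
==ᶠ⇒≡ u v e with u ≟ v
... | yes u≡v = u≡v

==ᶠ-suc : (u v : Fin n) → (suc u ==ᶠ suc v) ≡ (u ==ᶠ v)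
==ᶠ-suc u v with u ≟ v
... | yes _ = refl
... | no  _ = refl

fromBool : Bool → ℕ
fromBool true  = 1
fromBool false = 0

count : (Fin n → Bool) → ℕ
count {zero}  f = 0
count {suc n} f = fromBool (f zero) + count (λ i → f (suc i))

count-cong : (f g : Fin n → Bool) → (∀ i → f i ≡ g i) → count f ≡ count g
count-cong {zero}  f g e = refl
count-cong {suc n} f g e = cong₂ _+_ (cong fromBool (e zero)) (count-cong _ _ (λ i → e (suc i)))

∣p∣≡count : (p : Subset n) → ∣ p ∣ ≡ count (lookup p)
∣p∣≡count []          = refl
∣p∣≡count (true  ∷ p) = cong suc (∣p∣≡count p)
∣p∣≡count (false ∷ p) = ∣p∣≡count p

count-split : (f g : Fin n → Bool) →
  count f ≡ count (λ i → f i ∧ g i) + count (λ i → f i ∧ not (g i))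
count-split {zero}  f g = refl
count-split {suc n} f g = begin
  fromBool (f zero) + count (λ i → f (suc i))
    ≡⟨ cong₂ _+_ (bit-split (f zero) (g zero)) (count-split (λ i → f (suc i)) (λ i → g (suc i))) ⟩
  (fromBool (f zero ∧ g zero) + fromBool (f zero ∧ not (g zero))) + (count fg + count fg̅)
    ≡⟨ interchange (fromBool (f zero ∧ g zero)) (fromBool (f zero ∧ not (g zero))) (count fg) (count fg̅) ⟩
  count (λ i → f i ∧ g i) + count (λ i → f i ∧ not (g i)) ∎
  where
  open ≡-Reasoning
  fg fg̅ : Fin n → Bool
  fg  i = f (suc i) ∧ g (suc i)
  fg̅ i = f (suc i) ∧ not (g (suc i))
  bit-split : ∀ a b → fromBool a ≡ fromBool (a ∧ b) + fromBool (a ∧ not b)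
  bit-split true  true  = refl
  bit-split true  false = refl
  bit-split false _     = refl

count-∧-true== : (f g : Fin n → Bool) → count (λ i → f i ∧ (true == g i)) ≡ count (λ i → f i ∧ g i)
count-∧-true== f g = count-cong _ _ (λ i → cong (f i ∧_) (true==b (g i)))

count-∧-false== : (f g : Fin n → Bool) →
  count (λ i → f i ∧ (false == g i)) ≡ count f ∸ count (λ i → f i ∧ g i)
count-∧-false== f g = begin
  count (λ i → f i ∧ (false == g i))  ≡⟨ count-cong _ _ (λ i → cong (f i ∧_) (false==b (g i))) ⟩
  count f̅g                            ≡⟨ sym (m+n∸m≡n (count fg) (count f̅g)) ⟩
  count fg + count f̅g ∸ count fg      ≡⟨ cong (_∸ count fg) (sym (count-split f g)) ⟩
  count f ∸ count fg                  ∎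
  where
  open ≡-Reasoning
  fg f̅g : Fin _ → Bool
  fg  i = f i ∧ g i
  f̅g i = f i ∧ not (g i)

count-false : (f : Fin n → Bool) → (∀ i → f i ≡ false) → count f ≡ 0
count-false {zero}  f e = refl
count-false {suc n} f e rewrite e zero = count-false _ (λ i → e (suc i))

count≡0 : (f : Fin n → Bool) → count f ≡ 0 → ∀ i → f i ≡ false
count≡0 f e zero    with f zero
... | false = refl
count≡0 f e (suc i) with f zero
... | false = count≡0 (λ j → f (suc j)) e i

count-witness : (f : Fin n → Bool) → 1 ≤ count f → Σ (Fin n) (λ i → f i ≡ true)
count-witness {suc n} f pos with f zero in eq
... | true  = zero , eq
... | false with count-witness (λ i → f (suc i)) pos
...   | i , p = suc i , p

count-positive : (f : Fin n → Bool) (i : Fin n) → f i ≡ true → 1 ≤ count f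
count-positive f zero    p rewrite p = s≤s z≤n
count-positive f (suc i) p = ≤-trans (count-positive _ i p) (m≤n+m _ (fromBool (f zero)))

count-mono : (f g : Fin n → Bool) → (∀ i → f i ≡ true → g i ≡ true) → count f ≤ count g
count-mono {zero}  f g h = z≤n
count-mono {suc n} f g h with f zero in e
... | true  rewrite h zero e = s≤s (count-mono _ _ (λ i → h (suc i)))
... | false = ≤-trans (count-mono _ _ (λ i → h (suc i))) (m≤n+m _ (fromBool (g zero)))

count-∧≤ : (f g : Fin n → Bool) → count (λ i → f i ∧ g i) ≤ count f
count-∧≤ f g = count-mono _ f (λ i → ∧-conicalˡ (f i) (g i))

count-pick : (f : Fin n → Bool) (v : Fin n) →
  count f ≡ fromBool (f v) + count (λ i → f i ∧ not (v ==ᶠ i))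
count-pick f zero = cong (fromBool (f zero) +_)
  (cong₂ _+_ (cong fromBool (sym (∧-zeroʳ (f zero)))) (count-cong _ _ (λ i → sym (∧-identityʳ (f (suc i))))))
count-pick f (suc v) = begin
  fromBool (f zero) + count (λ i → f (suc i))
    ≡⟨ cong (fromBool (f zero) +_) (count-pick (λ i → f (suc i)) v) ⟩
  fromBool (f zero) + (fromBool (f (suc v)) + count (λ i → f (suc i) ∧ not (v ==ᶠ i)))
    ≡⟨ x∙yz≈y∙xz (fromBool (f zero)) (fromBool (f (suc v))) (count (λ i → f (suc i) ∧ not (v ==ᶠ i))) ⟩
  fromBool (f (suc v)) + (fromBool (f zero) + count (λ i → f (suc i) ∧ not (v ==ᶠ i)))
    ≡⟨ cong (fromBool (f (suc v)) +_) (cong₂ _+_ (cong fromBool (sym (∧-identityʳ (f zero))))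
         (count-cong _ _ (λ i → cong (λ b → f (suc i) ∧ not b) (sym (==ᶠ-suc v i))))) ⟩
  fromBool (f (suc v)) + count (λ i → f i ∧ not (suc v ==ᶠ i)) ∎
  where open ≡-Reasoning

count-remove : (f : Fin n → Bool) (v : Fin n) → f v ≡ true →
  count f ≡ suc (count (λ i → f i ∧ not (v ==ᶠ i)))
count-remove f v p = trans (count-pick f v) (cong (λ b → fromBool b + count (λ i → f i ∧ not (v ==ᶠ i))) p)

count-singleton : (u : Fin n) → count (u ==ᶠ_) ≡ 1
count-singleton u = begin
  count (u ==ᶠ_)                                 ≡⟨ count-remove _ u (==ᶠ-refl u) ⟩
  suc (count (λ i → (u ==ᶠ i) ∧ not (u ==ᶠ i)))  ≡⟨ cong suc (count-false _ (λ i → ∧-inverseʳ (u ==ᶠ i))) ⟩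
  1                                              ∎
  where open ≡-Reasoning

rank : (Fin n → Bool) → Fin n → ℕ
rank {suc n} K zero    = 0
rank {suc n} K (suc w) = fromBool (K zero) + rank (λ i → K (suc i)) w

rank-cong : (K L : Fin n → Bool) → (∀ i → K i ≡ L i) → ∀ w → rank K w ≡ rank L w
rank-cong K L e zero    = refl
rank-cong K L e (suc w) = cong₂ _+_ (cong fromBool (e zero)) (rank-cong _ _ (λ i → e (suc i)) w)

count-rank< : (K : Fin n → Bool) (a : ℕ) → count (λ w → K w ∧ (rank K w <ᵇ a)) ≡ a ⊓ count K
count-rank< {zero}  K zero    = refl
count-rank< {zero}  K (suc a) = refl
count-rank< {suc n} K zero    = count-false _ (λ i → ∧-zeroʳ (K i))
count-rank< {suc n} K (suc a) with K zero
... | true  = cong suc (count-rank< (λ i → K (suc i)) a)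
... | false = count-rank< (λ i → K (suc i)) (suc a)

-- Twins and types

module _ {n c} (G : ColoredGraph n c) where

  OpenTwins ClosedTwins SameColors SameType : Fin n → Fin n → Set
  OpenTwins   u v = ∀ w → E G u w ≡ E G v w
  ClosedTwins u v = ∀ w → closedN G u w ≡ closedN G v w
  SameColors  u v = ∀ i → lookup (color G i) u ≡ lookup (color G i) v
  SameType    u v = sameType G u v ≡ true

  sameType⇒ : ∀ u v → SameType u v → (OpenTwins u v ⊎ ClosedTwins u v) × SameColors u v
  sameType⇒ u v st = twins (∨-true _ _ (∧-conicalˡ _ _ st)) ,
                     (λ i → ==⇒≡ _ _ (allB⇒ _ (∧-conicalʳ _ _ st) i))
    where
    twins : _ → OpenTwins u v ⊎ ClosedTwins u v
    twins (inj₁ o)  = inj₁ (λ w → ==⇒≡ _ _ (allB⇒ _ o w))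
    twins (inj₂ cl) = inj₂ (λ w → ==⇒≡ _ _ (allB⇒ _ cl w))

  ⇒sameType : ∀ u v → OpenTwins u v ⊎ ClosedTwins u v → SameColors u v → SameType u v
  ⇒sameType u v twins cols = cong₂ _∧_ (twins-true twins) (⇒allB _ (λ i → ≡⇒== (cols i)))
    where
    open-twins closed-twins : Bool
    open-twins   = allB (λ w → E G u w == E G v w)
    closed-twins = allB (λ w → closedN G u w == closedN G v w)
    twins-true : OpenTwins u v ⊎ ClosedTwins u v → open-twins ∨ closed-twins ≡ true
    twins-true (inj₁ o)  = cong (_∨ closed-twins) (⇒allB _ (λ w → ≡⇒== (o w)))
    twins-true (inj₂ cl) = trans (cong (open-twins ∨_) (⇒allB _ (λ w → ≡⇒== (cl w)))) (∨-zeroʳ open-twins)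

  sameType-refl : ∀ u → SameType u u
  sameType-refl u = ⇒sameType u u (inj₁ (λ _ → refl)) (λ _ → refl)

  sameType-sym : ∀ u v → SameType u v → SameType v u
  sameType-sym u v st with sameType⇒ u v st
  ... | inj₁ o  , cols = ⇒sameType v u (inj₁ (λ w → sym (o w)))  (λ i → sym (cols i))
  ... | inj₂ cl , cols = ⇒sameType v u (inj₂ (λ w → sym (cl w))) (λ i → sym (cols i))

  closedN-≢ : ∀ u w → u ≢ w → closedN G u w ≡ E G u w
  closedN-≢ u w u≢w = cong (_∨ E G u w) (==ᶠ-≢ u≢w)

  closedN-refl : ∀ u → closedN G u u ≡ true
  closedN-refl u = cong (_∨ E G u u) (==ᶠ-refl u)

  -- Open twins are non-adjacent and distinct closed twins are adjacent, so a vertex cannot be an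
  -- open twin of u and a closed twin of w unless two of the three vertices coincide.
  ¬open-closed-twins : ∀ u v w → OpenTwins u v → ClosedTwins v w → u ≢ v → v ≢ w → u ≢ w → ⊥
  ¬open-closed-twins u v w o cl u≢v v≢w u≢w = true≢false (trans (sym u∈N[v]) u∉N[v])
    where
    E-vw : E G v w ≡ true
    E-vw = trans (sym (closedN-≢ v w v≢w)) (trans (cl w) (closedN-refl w))
    u∉N[v] : closedN G v u ≡ false
    u∉N[v] = trans (closedN-≢ v u (≢-sym u≢v)) (trans (E-sym G v u) (trans (o v) (E-irr G v)))
    u∈N[v] : closedN G v u ≡ true
    u∈N[v] = trans (cl u) (trans (closedN-≢ w u (≢-sym u≢w)) (trans (E-sym G w u) (trans (o w) E-vw)))

  sameType-trans-open-closed : ∀ u v w → OpenTwins u v → ClosedTwins v w →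
    SameType u v → SameType v w → SameType u w
  sameType-trans-open-closed u v w o cl uv vw with u ≟ v | v ≟ w | u ≟ w
  ... | yes refl | _        | _        = vw
  ... | no _     | yes refl | _        = uv
  ... | no _     | no _     | yes refl = sameType-refl u
  ... | no u≢v   | no v≢w   | no u≢w   = ⊥-elim (¬open-closed-twins u v w o cl u≢v v≢w u≢w)

  sameType-trans : ∀ u v w → SameType u v → SameType v w → SameType u w
  sameType-trans u v w uv vw with sameType⇒ u v uv | sameType⇒ v w vw
  ... | inj₁ o₁ , c₁ | inj₁ o₂ , c₂ =
    ⇒sameType u w (inj₁ (λ x → trans (o₁ x) (o₂ x))) (λ i → trans (c₁ i) (c₂ i))
  ... | inj₂ o₁ , c₁ | inj₂ o₂ , c₂ =
    ⇒sameType u w (inj₂ (λ x → trans (o₁ x) (o₂ x))) (λ i → trans (c₁ i) (c₂ i))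
  ... | inj₁ o₁ , _ | inj₂ o₂ , _ = sameType-trans-open-closed u v w o₁ o₂ uv vw
  ... | inj₂ o₁ , _ | inj₁ o₂ , _ = sameType-sym w u
    (sameType-trans-open-closed w v u (λ x → sym (o₂ x)) (λ x → sym (o₁ x))
      (sameType-sym v w vw) (sameType-sym u v uv))

  sameType-congˡ : ∀ t t' w → SameType t t' → sameType G t w ≡ sameType G t' w
  sameType-congˡ t t' w tt' = ≡-fromImplications
    (sameType-trans t' t w (sameType-sym t t' tt')) (sameType-trans t t' w tt')

  sameType-congʳ : ∀ t u v → SameType u v → sameType G t u ≡ sameType G t v
  sameType-congʳ t u v uv = ≡-fromImplications
    (λ tu → sameType-trans t u v tu uv) (λ tv → sameType-trans t v u tv (sameType-sym u v uv))

  sameType-E : ∀ u u' w → SameType u u' → w ≢ u → w ≢ u' → E G u w ≡ E G u' w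
  sameType-E u u' w st w≢u w≢u' with proj₁ (sameType⇒ u u' st)
  ... | inj₁ o  = o w
  ... | inj₂ cl = trans (sym (closedN-≢ u w (≢-sym w≢u))) (trans (cl w) (closedN-≢ u' w (≢-sym w≢u')))

  E-respects-sameType : ∀ a a' b b' → SameType a a' → SameType b b' →
    (a ≡ b → a' ≡ b') → (a' ≡ b' → a ≡ b) → E G a b ≡ E G a' b'
  E-respects-sameType a a' b b' aa' bb' to from with a ≟ b
  ... | yes refl rewrite to refl = trans (E-irr G a) (sym (E-irr G b'))
  ... | no a≢b with b ≟ a'
  ...   | no b≢a' = begin
    E G a b    ≡⟨ sameType-E a a' b aa' (≢-sym a≢b) b≢a' ⟩
    E G a' b   ≡⟨ E-sym G a' b ⟩
    E G b a'   ≡⟨ sameType-E b b' a' bb' (≢-sym b≢a') (λ a'≡b' → a≢b (from a'≡b')) ⟩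
    E G b' a'  ≡⟨ E-sym G b' a' ⟩
    E G a' b'  ∎
    where open ≡-Reasoning
  ...   | yes refl with a ≟ b'
  ...     | yes refl = E-sym G a b
  ...     | no a≢b'  = trans
    (sameType-E a b' b (sameType-trans a b b' aa' bb') (≢-sym a≢b) (λ b≡b' → a≢b (from b≡b'))) (E-sym G b' b)

infix 4 _≈[_]_

_≈[_]_ : ℕ → ℕ → ℕ → Set
a ≈[ m ] b = a ≡ b ⊎ (m ≤ a × m ≤ b)

≈-sym : ∀ {m a b} → a ≈[ m ] b → b ≈[ m ] a
≈-sym (inj₁ a≡b)     = inj₁ (sym a≡b)
≈-sym (inj₂ (a , b)) = inj₂ (b , a)

≈-mono : ∀ {m m' a b} → m' ≤ m → a ≈[ m ] b → a ≈[ m' ] b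
≈-mono _     (inj₁ a≡b)     = inj₁ a≡b
≈-mono m'≤m (inj₂ (a , b)) = inj₂ (≤-trans m'≤m a , ≤-trans m'≤m b)

≈-pred : ∀ {m a b} → suc a ≈[ m ] suc b → a ≈[ m ∸ 1 ] b
≈-pred (inj₁ e)       = inj₁ (suc-injective e)
≈-pred (inj₂ (a , b)) = inj₂ (∸-monoˡ-≤ 1 a , ∸-monoˡ-≤ 1 b)

≈-positive : ∀ {m a b} → a ≈[ m ] b → 1 ≤ m → 1 ≤ a → 1 ≤ b
≈-positive (inj₁ refl)    _   1≤a = 1≤a
≈-positive (inj₂ (_ , b)) 1≤m _   = ≤-trans 1≤m b

m+m≤o⇒m≤o∸n : ∀ m {n o} → m + m ≤ o → n ≤ m → m ≤ o ∸ n
m+m≤o⇒m≤o∸n m {n} {o} m+m≤o n≤m = subst (_≤ o ∸ n) (m+n∸n≡m m m) (∸-mono m+m≤o n≤m)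

-- Duplicator's answer in a set round: Spoiler put a of the c elements of a cell into his set,
-- and Duplicator puts splitCount m a c c' of the c' elements of the corresponding cell into hers.
splitCount : ℕ → ℕ → ℕ → ℕ → ℕ
splitCount m a c c' with c ≟ℕ c'
... | yes _ = a
... | no  _ with a <? m
...   | yes _ = a
...   | no  _ with c ∸ a <? m
...     | yes _ = c' ∸ (c ∸ a)
...     | no  _ = m

splitCount-correct : ∀ m a c c' → a ≤ c → c ≈[ m + m ] c' →
  splitCount m a c c' ≤ c' × a ≈[ m ] splitCount m a c c' × c ∸ a ≈[ m ] c' ∸ splitCount m a c c'
splitCount-correct m a c c' a≤c c≈c' with c ≟ℕ c'
... | yes refl = a≤c , inj₁ refl , inj₁ refl
... | no c≢c' with c≈c'
...   | inj₁ c≡c' = ⊥-elim (c≢c' c≡c')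
...   | inj₂ (2m≤c , 2m≤c') with a <? m
...     | yes a<m = ≤-trans (<⇒≤ a<m) (≤-trans (m≤m+n m m) 2m≤c') , inj₁ refl ,
                    inj₂ (m+m≤o⇒m≤o∸n m 2m≤c (<⇒≤ a<m) , m+m≤o⇒m≤o∸n m 2m≤c' (<⇒≤ a<m))
...     | no a≮m with c ∸ a <? m
...       | yes d<m = m∸n≤m c' (c ∸ a) , inj₂ (≮⇒≥ a≮m , m+m≤o⇒m≤o∸n m 2m≤c' (<⇒≤ d<m)) ,
                      inj₁ (sym (m∸[m∸n]≡n (≤-trans (<⇒≤ d<m) (≤-trans (m≤m+n m m) 2m≤c'))))
...       | no d≮m  = ≤-trans (m≤m+n m m) 2m≤c' , inj₂ (≮⇒≥ a≮m , ≤-refl) ,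
                      inj₂ (≮⇒≥ d≮m , m+m≤o⇒m≤o∸n m 2m≤c' ≤-refl)

≈-remove : ∀ {m a a'} b → fromBool b + a ≈[ m ] fromBool b + a' → a ≈[ m ∸ 1 ] a'
≈-remove {m} false = ≈-mono (m∸n≤m m 1)
≈-remove true      = ≈-pred

-- The Ehrenfeucht–Fraïssé game

sameProfile : ∀ {ns} → (Fin ns → Bool) → (Fin ns → Bool) → Bool
sameProfile p q = allB (λ X → p X == q X)

sameProfile⇒ : ∀ {ns} (p q : Fin ns → Bool) → sameProfile p q ≡ true → ∀ X → p X ≡ q X
sameProfile⇒ p q e X = ==⇒≡ _ _ (allB⇒ _ e X)

sameProfile-refl : ∀ {ns} (p : Fin ns → Bool) → sameProfile p p ≡ true
sameProfile-refl p = ⇒allB _ (λ X → ≡⇒== {p X} refl)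

sameProfile-cong : ∀ {ns} {p p' q q' : Fin ns → Bool} → (∀ X → p X ≡ p' X) → (∀ X → q X ≡ q' X) →
  sameProfile p q ≡ sameProfile p' q'
sameProfile-cong p≗p' q≗q' = allB-cong _ _ (λ X → cong₂ _==_ (p≗p' X) (q≗q' X))

extend-equalities : ∀ {A : Set} {nv} {ρ ρ' : Fin nv → A} {v v' : A} →
  (∀ x y → ρ x ≡ ρ y → ρ' x ≡ ρ' y) → (∀ y → v ≡ ρ y → v' ≡ ρ' y) →
  ∀ a b → extend v ρ a ≡ extend v ρ b → extend v' ρ' a ≡ extend v' ρ' b
extend-equalities old new zero    zero    e = refl
extend-equalities old new zero    (suc b) e = new b e
extend-equalities old new (suc a) zero    e = sym (new a (sym e))
extend-equalities old new (suc a) (suc b) e = old a b e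

module _ {n c} (G : ColoredGraph n c) where

  pinned : ∀ {nv} → (Fin nv → Fin n) → Fin n → Bool
  pinned ρv w = anyB (λ x → ρv x ==ᶠ w)

  pinned-value : ∀ {nv} (ρv : Fin nv → Fin n) x → pinned ρv (ρv x) ≡ true
  pinned-value ρv x = ⇒anyB _ x (==ᶠ-refl (ρv x))

  unpinned-≢ : ∀ {nv} (ρv : Fin nv → Fin n) w → pinned ρv w ≡ false → ∀ x → ρv x ≢ w
  unpinned-≢ ρv w unpinned x refl = true≢false (trans (sym (pinned-value ρv x)) unpinned)

  pinned⇒value : ∀ {nv} (ρv : Fin nv → Fin n) w → pinned ρv w ≡ true → Σ (Fin nv) (λ x → ρv x ≡ w)
  pinned⇒value ρv w e with anyB⇒ _ e
  ... | x , p = x , ==ᶠ⇒≡ (ρv x) w p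

  profile : ∀ {ns} → (Fin ns → Subset n) → Fin n → Fin ns → Bool
  profile ρs w X = lookup (ρs X) w

  cell : ∀ {nv ns} → (Fin nv → Fin n) → (Fin ns → Subset n) → Fin n → (Fin ns → Bool) → Fin n → Bool
  cell ρv ρs t p w = sameType G t w ∧ (not (pinned ρv w) ∧ sameProfile p (profile ρs w))

  cellSize : ∀ {nv ns} → (Fin nv → Fin n) → (Fin ns → Subset n) → Fin n → (Fin ns → Bool) → ℕ
  cellSize ρv ρs t p = count (cell ρv ρs t p)

  cell-cong : ∀ {nv ns} (ρv : Fin nv → Fin n) (ρs : Fin ns → Subset n) {t t' p p'} →
    SameType G t t' → (∀ X → p X ≡ p' X) → ∀ w → cell ρv ρs t p w ≡ cell ρv ρs t' p' w
  cell-cong ρv ρs {t} {t'} tt' p≗p' w =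
    cong₂ _∧_ (sameType-congˡ G t t' w tt') (cong (not (pinned ρv w) ∧_) (sameProfile-cong p≗p' (λ _ → refl)))

  cellSize-cong : ∀ {nv ns} (ρv : Fin nv → Fin n) (ρs : Fin ns → Subset n) {t t' p p'} →
    SameType G t t' → (∀ X → p X ≡ p' X) → cellSize ρv ρs t p ≡ cellSize ρv ρs t' p'
  cellSize-cong ρv ρs tt' p≗p' = count-cong _ _ (cell-cong ρv ρs tt' p≗p')

  -- Duplicator's invariant, with threshold m.
  record Similar (m : ℕ) {nv ns} (ρv ρv' : Fin nv → Fin n) (ρs ρs' : Fin ns → Subset n) : Set where
    field
      equal⇒equal : ∀ x y → ρv x ≡ ρv y → ρv' x ≡ ρv' y
      equal⇐equal : ∀ x y → ρv' x ≡ ρv' y → ρv x ≡ ρv y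
      sameTypes   : ∀ x → SameType G (ρv x) (ρv' x)
      sameMembers : ∀ x X → lookup (ρs X) (ρv x) ≡ lookup (ρs' X) (ρv' x)
      cellSizes   : ∀ t p → cellSize ρv ρs t p ≈[ m ] cellSize ρv' ρs' t p
  open Similar public

  similar-sym : ∀ {m nv ns} {ρv ρv' : Fin nv → Fin n} {ρs ρs' : Fin ns → Subset n} →
    Similar m ρv ρv' ρs ρs' → Similar m ρv' ρv ρs' ρs
  similar-sym {ρv = ρv} {ρv'} s = record
    { equal⇒equal = equal⇐equal s
    ; equal⇐equal = equal⇒equal s
    ; sameTypes   = λ x → sameType-sym G (ρv x) (ρv' x) (sameTypes s x)
    ; sameMembers = λ x X → sym (sameMembers s x X)
    ; cellSizes   = λ t p → ≈-sym (cellSizes s t p) }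

  cellSize-extend : ∀ {nv ns} (ρv : Fin nv → Fin n) (ρs : Fin ns → Subset n) v t p →
    cellSize (extend v ρv) ρs t p ≡ count (λ w → cell ρv ρs t p w ∧ not (v ==ᶠ w))
  cellSize-extend ρv ρs v t p = count-cong _ _ λ w →
    reorder (sameType G t w) (pinned ρv w) (sameProfile p (profile ρs w)) (v ==ᶠ w)
    where
    reorder : ∀ a b c e → a ∧ (not (e ∨ b) ∧ c) ≡ (a ∧ (not b ∧ c)) ∧ not e
    reorder false _     _     _     = refl
    reorder true  true  _     true  = refl
    reorder true  true  _     false = refl
    reorder true  false true  true  = refl
    reorder true  false true  false = refl
    reorder true  false false true  = refl
    reorder true  false false false = refl

  cellSize-extend-pinned : ∀ {nv ns} (ρv : Fin nv → Fin n) (ρs : Fin ns → Subset n) v →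
    pinned ρv v ≡ true → ∀ t p → cellSize (extend v ρv) ρs t p ≡ cellSize ρv ρs t p
  cellSize-extend-pinned ρv ρs v pv t p = count-cong _ _ λ w →
    cong (λ b → sameType G t w ∧ (not b ∧ sameProfile p (profile ρs w))) (absorb w)
    where
    absorb : ∀ w → (v ==ᶠ w) ∨ pinned ρv w ≡ pinned ρv w
    absorb w with v ≟ w
    ... | yes refl = sym pv
    ... | no  _    = refl

  module _ {m nv ns} {ρv ρv' : Fin nv → Fin n} {ρs ρs' : Fin ns → Subset n}
           (s : Similar m ρv ρv' ρs ρs') where

    pinnedRound : ∀ x → Similar (m ∸ 1) (extend (ρv x) ρv) (extend (ρv' x) ρv') ρs ρs'
    pinnedRound x = record
      { equal⇒equal = extend-equalities (equal⇒equal s) (equal⇒equal s x)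
      ; equal⇐equal = extend-equalities (equal⇐equal s) (equal⇐equal s x)
      ; sameTypes   = λ { zero → sameTypes s x ; (suc y) → sameTypes s y }
      ; sameMembers = λ { zero → sameMembers s x ; (suc y) → sameMembers s y }
      ; cellSizes   = λ t p → subst₂ (_≈[ m ∸ 1 ]_)
          (sym (cellSize-extend-pinned ρv ρs (ρv x) (pinned-value ρv x) t p))
          (sym (cellSize-extend-pinned ρv' ρs' (ρv' x) (pinned-value ρv' x) t p))
          (≈-mono (m∸n≤m m 1) (cellSizes s t p)) }

    freshPartner : 1 ≤ m → ∀ v → pinned ρv v ≡ false →
      Σ (Fin n) λ u → SameType G v u × pinned ρv' u ≡ false × (∀ X → profile ρs v X ≡ profile ρs' u X)
    freshPartner 1≤m v unpinned with count-witness _ v's-cell-nonempty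
      where
      v∈cell : cell ρv ρs v (profile ρs v) v ≡ true
      v∈cell rewrite sameType-refl G v | unpinned | sameProfile-refl (profile ρs v) = refl
      v's-cell-nonempty : 1 ≤ cellSize ρv' ρs' v (profile ρs v)
      v's-cell-nonempty = ≈-positive (cellSizes s v (profile ρs v)) 1≤m (count-positive _ v v∈cell)
    ... | u , u∈cell = u , ∧-conicalˡ (sameType G v u) _ u∈cell ,
      not-injective (∧-conicalˡ (not (pinned ρv' u)) _ in-rest) ,
      sameProfile⇒ _ _ (∧-conicalʳ (not (pinned ρv' u)) _ in-rest)
      where
      in-rest : not (pinned ρv' u) ∧ sameProfile (profile ρs v) (profile ρs' u) ≡ true
      in-rest = ∧-conicalʳ (sameType G v u) _ u∈cell

    freshRound : 1 ≤ m → ∀ v → pinned ρv v ≡ false →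
      Σ (Fin n) λ u → Similar (m ∸ 1) (extend v ρv) (extend u ρv') ρs ρs'
    freshRound 1≤m v unpinned with freshPartner 1≤m v unpinned
    ... | u , vu , u-unpinned , profiles = u , record
      { equal⇒equal = extend-equalities (equal⇒equal s) (λ y v≡ → ⊥-elim (unpinned-≢ ρv v unpinned y (sym v≡)))
      ; equal⇐equal = extend-equalities (equal⇐equal s) (λ y u≡ → ⊥-elim (unpinned-≢ ρv' u u-unpinned y (sym u≡)))
      ; sameTypes   = λ { zero → vu ; (suc y) → sameTypes s y }
      ; sameMembers = λ { zero → profiles ; (suc y) → sameMembers s y }
      ; cellSizes   = cellSizes-after }
      where
      same-cells : ∀ t p → cell ρv ρs t p v ≡ cell ρv' ρs' t p u
      same-cells t p = cong₂ _∧_ (sameType-congʳ G t v u vu)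
        (cong₂ _∧_ (cong not (trans unpinned (sym u-unpinned))) (sameProfile-cong {p = p} (λ _ → refl) profiles))
      cellSizes-after : ∀ t p → cellSize (extend v ρv) ρs t p ≈[ m ∸ 1 ] cellSize (extend u ρv') ρs' t p
      cellSizes-after t p rewrite cellSize-extend ρv ρs v t p | cellSize-extend ρv' ρs' u t p =
        ≈-remove (cell ρv ρs t p v) (subst₂ (_≈[ m ]_) (count-pick _ v)
          (trans (count-pick _ u)
            (cong (λ b → fromBool b + count (λ w → cell ρv' ρs' t p w ∧ not (u ==ᶠ w))) (sym (same-cells t p))))
          (cellSizes s t p))

    vertexRound : 1 ≤ m → ∀ v → Σ (Fin n) λ v' → Similar (m ∸ 1) (extend v ρv) (extend v' ρv') ρs ρs'
    vertexRound 1≤m v with pinned ρv v in pv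
    ... | false = freshRound 1≤m v pv
    ... | true with pinned⇒value ρv v pv
    ...   | x , refl = ρv' x , pinnedRound x

  cellSize-extend-set : ∀ {nv ns} (ρv : Fin nv → Fin n) (ρs : Fin ns → Subset n) Z t (p : Fin (suc ns) → Bool) →
    cellSize ρv (extend Z ρs) t p ≡ count (λ w → cell ρv ρs t (p ∘ suc) w ∧ (p zero == lookup Z w))
  cellSize-extend-set ρv ρs Z t p = count-cong _ _ λ w →
    reorder (sameType G t w) (not (pinned ρv w)) (p zero == lookup Z w) (sameProfile (p ∘ suc) (profile ρs w))
    where
    reorder : ∀ a b c d → a ∧ (b ∧ (c ∧ d)) ≡ (a ∧ (b ∧ d)) ∧ c
    reorder false _     _     _     = refl
    reorder true  false _     _     = refl
    reorder true  true  true  true  = refl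
    reorder true  true  true  false = refl
    reorder true  true  false true  = refl
    reorder true  true  false false = refl

  module SetRound {m m' nv ns} {ρv ρv' : Fin nv → Fin n} {ρs ρs' : Fin ns → Subset n}
                  (s : Similar m ρv ρv' ρs ρs') (2m'≤m : m' + m' ≤ m) (Y : Subset n) where

    chosen : Fin n → (Fin ns → Bool) → ℕ
    chosen t p = count (λ w → cell ρv ρs t p w ∧ lookup Y w)

    answer : Fin n → (Fin ns → Bool) → ℕ
    answer t p = splitCount m' (chosen t p) (cellSize ρv ρs t p) (cellSize ρv' ρs' t p)

    answer-correct : ∀ t p → answer t p ≤ cellSize ρv' ρs' t p ×
      chosen t p ≈[ m' ] answer t p × cellSize ρv ρs t p ∸ chosen t p ≈[ m' ] cellSize ρv' ρs' t p ∸ answer t p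
    answer-correct t p = splitCount-correct m' (chosen t p) (cellSize ρv ρs t p) (cellSize ρv' ρs' t p)
      (count-∧≤ (cell ρv ρs t p) (lookup Y)) (≈-mono 2m'≤m (cellSizes s t p))

    copiedFromPinned : Fin n → Bool
    copiedFromPinned w = anyB (λ x → (ρv' x ==ᶠ w) ∧ lookup Y (ρv x))

    ownCell : Fin n → Fin n → Bool
    ownCell w = cell ρv' ρs' w (profile ρs' w)

    early : Fin n → Bool
    early w = rank (ownCell w) w <ᵇ answer w (profile ρs' w)

    -- The partners of the pinned members of Y, together with the first answer t p vertices
    -- (in index order) of every cell (t, p).
    Y' : Subset n
    Y' = tabulate λ w → copiedFromPinned w ∨ (not (pinned ρv' w) ∧ early w)

    Y'-pinned : ∀ x → lookup Y' (ρv' x) ≡ lookup Y (ρv x)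
    Y'-pinned x = begin
      lookup Y' (ρv' x)
        ≡⟨ lookup∘tabulate _ (ρv' x) ⟩
      copiedFromPinned (ρv' x) ∨ (not (pinned ρv' (ρv' x)) ∧ early (ρv' x))
        ≡⟨ cong₂ (λ a b → a ∨ (not b ∧ early (ρv' x))) copied (pinned-value ρv' x) ⟩
      lookup Y (ρv x) ∨ false
        ≡⟨ ∨-identityʳ (lookup Y (ρv x)) ⟩
      lookup Y (ρv x) ∎
      where
      open ≡-Reasoning
      copied : copiedFromPinned (ρv' x) ≡ lookup Y (ρv x)
      copied = ≡-fromImplications
        (λ e → let y , hy = anyB⇒ _ e
                   y≡x = equal⇐equal s y x (==ᶠ⇒≡ _ _ (∧-conicalˡ _ _ hy))
               in trans (cong (lookup Y) (sym y≡x)) (∧-conicalʳ _ _ hy))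
        (λ e → ⇒anyB _ x (cong₂ _∧_ (==ᶠ-refl (ρv' x)) e))

    Y'-cell : ∀ t p w → cell ρv' ρs' t p w ≡ true → lookup Y' w ≡ (rank (cell ρv' ρs' t p) w <ᵇ answer t p)
    Y'-cell t p w w∈cell = begin
      lookup Y' w
        ≡⟨ lookup∘tabulate _ w ⟩
      copiedFromPinned w ∨ (not (pinned ρv' w) ∧ early w)
        ≡⟨ cong₂ (λ a b → a ∨ (not b ∧ early w)) not-copied unpinned ⟩
      rank (ownCell w) w <ᵇ answer w (profile ρs' w)
        ≡⟨ cong₂ _<ᵇ_ (rank-cong _ _ (cell-cong ρv' ρs' wt profile≗p) w)
                      (cong₃ (splitCount m')
                        (count-cong _ _ (λ u → cong (_∧ lookup Y u) (cell-cong ρv ρs wt profile≗p u)))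
                        (cellSize-cong ρv ρs wt profile≗p) (cellSize-cong ρv' ρs' wt profile≗p)) ⟩
      rank (cell ρv' ρs' t p) w <ᵇ answer t p ∎
      where
      open ≡-Reasoning
      rest : not (pinned ρv' w) ∧ sameProfile p (profile ρs' w) ≡ true
      rest = ∧-conicalʳ (sameType G t w) _ w∈cell
      wt : SameType G w t
      wt = sameType-sym G t w (∧-conicalˡ _ _ w∈cell)
      unpinned : pinned ρv' w ≡ false
      unpinned = not-injective (∧-conicalˡ (not (pinned ρv' w)) _ rest)
      profile≗p : ∀ X → profile ρs' w X ≡ p X
      profile≗p X = sym (sameProfile⇒ p (profile ρs' w) (∧-conicalʳ (not (pinned ρv' w)) _ rest) X)
      not-copied : copiedFromPinned w ≡ false
      not-copied = false-anyB _ λ y → cong (_∧ lookup Y (ρv y)) (==ᶠ-≢ {u = ρv' y} {w} (unpinned-≢ ρv' w unpinned y))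
      cong₃ : ∀ (f : ℕ → ℕ → ℕ → ℕ) {a b c a' b' c'} → a ≡ a' → b ≡ b' → c ≡ c' → f a b c ≡ f a' b' c'
      cong₃ f refl refl refl = refl

    chosen' : ∀ t p → count (λ w → cell ρv' ρs' t p w ∧ lookup Y' w) ≡ answer t p
    chosen' t p = begin
      count (λ w → cell ρv' ρs' t p w ∧ lookup Y' w)
        ≡⟨ count-cong _ _ by-rank ⟩
      count (λ w → cell ρv' ρs' t p w ∧ (rank (cell ρv' ρs' t p) w <ᵇ answer t p))
        ≡⟨ count-rank< (cell ρv' ρs' t p) (answer t p) ⟩
      answer t p ⊓ cellSize ρv' ρs' t p
        ≡⟨ m≤n⇒m⊓n≡m (proj₁ (answer-correct t p)) ⟩
      answer t p ∎
      where
      open ≡-Reasoning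
      by-rank : ∀ w → cell ρv' ρs' t p w ∧ lookup Y' w
                    ≡ cell ρv' ρs' t p w ∧ (rank (cell ρv' ρs' t p) w <ᵇ answer t p)
      by-rank w with cell ρv' ρs' t p w in w∈cell
      ... | false = refl
      ... | true  = Y'-cell t p w w∈cell

    cellSizes-after : ∀ t p → cellSize ρv (extend Y ρs) t p ≈[ m' ] cellSize ρv' (extend Y' ρs') t p
    cellSizes-after t p rewrite cellSize-extend-set ρv ρs Y t p | cellSize-extend-set ρv' ρs' Y' t p
      with p zero
    ... | true  rewrite count-∧-true== (cell ρv ρs t (p ∘ suc)) (lookup Y)
                      | count-∧-true== (cell ρv' ρs' t (p ∘ suc)) (lookup Y')
                      | chosen' t (p ∘ suc) = proj₁ (proj₂ (answer-correct t (p ∘ suc)))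
    ... | false rewrite count-∧-false== (cell ρv ρs t (p ∘ suc)) (lookup Y)
                      | count-∧-false== (cell ρv' ρs' t (p ∘ suc)) (lookup Y')
                      | chosen' t (p ∘ suc) = proj₂ (proj₂ (answer-correct t (p ∘ suc)))

    similar : Similar m' ρv ρv' (extend Y ρs) (extend Y' ρs')
    similar = record
      { equal⇒equal = equal⇒equal s
      ; equal⇐equal = equal⇐equal s
      ; sameTypes   = sameTypes s
      ; sameMembers = λ { x zero → sym (Y'-pinned x) ; x (suc X) → sameMembers s x X }
      ; cellSizes   = cellSizes-after }

  setRound : ∀ {m m' nv ns} {ρv ρv' : Fin nv → Fin n} {ρs ρs' : Fin ns → Subset n} →
    Similar m ρv ρv' ρs ρs' → m' + m' ≤ m → ∀ Y → Σ (Subset n) λ Y' → Similar m' ρv ρv' (extend Y ρs) (extend Y' ρs')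
  setRound s 2m'≤m Y = SetRound.Y' s 2m'≤m Y , SetRound.similar s 2m'≤m Y

q-left : ∀ a b c d → 2 ^ a * b ≤ 2 ^ (a + c) * (b + d)
q-left a b c d = *-mono-≤ (^-monoʳ-≤ 2 (m≤m+n a c)) (m≤m+n b d)

q-right : ∀ a b c d → 2 ^ c * d ≤ 2 ^ (a + c) * (b + d)
q-right a b c d = *-mono-≤ (^-monoʳ-≤ 2 (m≤n+m c a)) (m≤n+m d b)

q-vertex-positive : ∀ s r {m} → 2 ^ s * suc r ≤ m → 1 ≤ m
q-vertex-positive s r le = ≤-trans (m^n>0 2 s) (≤-trans (m≤m*n (2 ^ s) (suc r)) le)

q-vertex : ∀ s r {m} → 2 ^ s * suc r ≤ m → 2 ^ s * r ≤ m ∸ 1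
q-vertex s r {m} le = begin
  2 ^ s * r              ≤⟨ m≤n+m (2 ^ s * r) (2 ^ s ∸ 1) ⟩
  2 ^ s ∸ 1 + 2 ^ s * r  ≡⟨ sym (+-∸-comm (2 ^ s * r) (m^n>0 2 s)) ⟩
  2 ^ s + 2 ^ s * r ∸ 1  ≡⟨ cong (_∸ 1) (sym (*-suc (2 ^ s) r)) ⟩
  2 ^ s * suc r ∸ 1      ≤⟨ ∸-monoˡ-≤ 1 le ⟩
  m ∸ 1                  ∎
  where open ≤-Reasoning

q-set : ∀ s r {m} → 2 ^ suc s * r ≤ m → 2 ^ s * r + 2 ^ s * r ≤ m
q-set s r {m} = subst (_≤ m) (trans (*-assoc 2 (2 ^ s) r) (cong (2 ^ s * r +_) (+-identityʳ (2 ^ s * r))))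

module _ {n c} (G : ColoredGraph n c) where

  similar⇒⟦⟧ : ∀ {m nv ns} (ψ : Formula c nv ns) {ρv ρv' : Fin nv → Fin n} {ρs ρs' : Fin ns → Subset n} →
    Similar G m ρv ρv' ρs ρs' → q ψ ≤ m → ⟦ ψ ⟧ G ρv ρs → ⟦ ψ ⟧ G ρv' ρs'
  similar⇒⟦⟧ (x ≐ y) s _ h = equal⇒equal s x y h
  similar⇒⟦⟧ (edge x y) {ρv} {ρv'} s _ h = trans (sym (E-respects-sameType G (ρv x) (ρv' x) (ρv y) (ρv' y)
    (sameTypes s x) (sameTypes s y) (equal⇒equal s x y) (equal⇐equal s x y))) h
  similar⇒⟦⟧ (col i x) {ρv} {ρv'} s _ h =
    lookup⇒[]= (ρv' x) (color G i) (trans (sym (proj₂ (sameType⇒ G (ρv x) (ρv' x) (sameTypes s x)) i)) ([]=⇒lookup h))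
  similar⇒⟦⟧ (mem X x) {ρv} {ρv'} {ρs} {ρs'} s _ h =
    lookup⇒[]= (ρv' x) (ρs' X) (trans (sym (sameMembers s x X)) ([]=⇒lookup h))
  similar⇒⟦⟧ (¬' ψ) s le h h' = h (similar⇒⟦⟧ ψ (similar-sym G s) le h')
  similar⇒⟦⟧ (ψ ∧' χ) s le (hψ , hχ) =
    similar⇒⟦⟧ ψ s (≤-trans (q-left (qs ψ) (qv ψ) (qs χ) (qv χ)) le) hψ ,
    similar⇒⟦⟧ χ s (≤-trans (q-right (qs ψ) (qv ψ) (qs χ) (qv χ)) le) hχ
  similar⇒⟦⟧ (ψ ∨' χ) s le (inj₁ hψ) = inj₁ (similar⇒⟦⟧ ψ s (≤-trans (q-left (qs ψ) (qv ψ) (qs χ) (qv χ)) le) hψ)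
  similar⇒⟦⟧ (ψ ∨' χ) s le (inj₂ hχ) = inj₂ (similar⇒⟦⟧ χ s (≤-trans (q-right (qs ψ) (qv ψ) (qs χ) (qv χ)) le) hχ)
  similar⇒⟦⟧ (ψ ⇒' χ) s le f hψ =
    similar⇒⟦⟧ χ s (≤-trans (q-right (qs ψ) (qv ψ) (qs χ) (qv χ)) le)
      (f (similar⇒⟦⟧ ψ (similar-sym G s) (≤-trans (q-left (qs ψ) (qv ψ) (qs χ) (qv χ)) le) hψ))
  similar⇒⟦⟧ (∃v ψ) s le (v , h) with vertexRound G s (q-vertex-positive (qs ψ) (qv ψ) le) v
  ... | v' , s' = v' , similar⇒⟦⟧ ψ s' (q-vertex (qs ψ) (qv ψ) le) h
  similar⇒⟦⟧ (∀v ψ) s le h v' with vertexRound G (similar-sym G s) (q-vertex-positive (qs ψ) (qv ψ) le) v'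
  ... | v , s' = similar⇒⟦⟧ ψ (similar-sym G s') (q-vertex (qs ψ) (qv ψ) le) (h v)
  similar⇒⟦⟧ (∃s ψ) s le (Y , h) with setRound G s (q-set (qs ψ) (qv ψ) le) Y
  ... | Y' , s' = Y' , similar⇒⟦⟧ ψ s' ≤-refl h
  similar⇒⟦⟧ (∀s ψ) s le h Y' with setRound G (similar-sym G s) (q-set (qs ψ) (qv ψ) le) Y'
  ... | Y , s' = similar⇒⟦⟧ ψ (similar-sym G s') ≤-refl (h Y)

-- Shapes

nothing≢just : ∀ {a : ℕ} → nothing ≢ just a
nothing≢just ()

data ShapeView (m s a : ℕ) : Set where
  middle : m ≤ a → a ≤ s ∸ m → shapeVal m s a ≡ nothing → ShapeView m s a
  exact  : shapeVal m s a ≡ just a → ShapeView m s a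

inMiddle : ℕ → ℕ → ℕ → Bool
inMiddle m s a = (m ≤ᵇ a) ∧ (a ≤ᵇ s ∸ m)

shapeVal-inMiddle : ∀ m s a → inMiddle m s a ≡ true → shapeVal m s a ≡ nothing
shapeVal-inMiddle m s a e with (m ≤ᵇ a) ∧ (a ≤ᵇ s ∸ m)
shapeVal-inMiddle m s a e  | true  = refl
shapeVal-inMiddle m s a () | false

shapeVal-¬inMiddle : ∀ m s a → inMiddle m s a ≡ false → shapeVal m s a ≡ just a
shapeVal-¬inMiddle m s a e  with (m ≤ᵇ a) ∧ (a ≤ᵇ s ∸ m)
shapeVal-¬inMiddle m s a () | true
shapeVal-¬inMiddle m s a e  | false = refl

shapeView : ∀ m s a → ShapeView m s a
shapeView m s a with inMiddle m s a in e
... | true  = middle (≤ᵇ⇒≤ m a (Equivalence.from T-≡ (∧-conicalˡ _ _ e)))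
                     (≤ᵇ⇒≤ a (s ∸ m) (Equivalence.from T-≡ (∧-conicalʳ _ _ e))) (shapeVal-inMiddle m s a e)
... | false = exact (shapeVal-¬inMiddle m s a e)

shapeVal-middle : ∀ m s a → m ≤ a → a ≤ s ∸ m → shapeVal m s a ≡ nothing
shapeVal-middle m s a m≤a a≤s∸m = shapeVal-inMiddle m s a
  (cong₂ _∧_ (Equivalence.to T-≡ (≤⇒≤ᵇ m≤a)) (Equivalence.to T-≡ (≤⇒≤ᵇ a≤s∸m)))

middle-complement : ∀ m s a → m ≤ a → a ≤ s ∸ m → m ≤ s ∸ a
middle-complement m s a m≤a a≤s∸m =
  m+n≤o⇒m≤o∸n m (subst (_≤ s) (+-comm a m) (m≤o∸n⇒m+n≤o a (≤-trans m≤a (≤-trans a≤s∸m (m∸n≤m s m))) a≤s∸m))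

shapeVal⇒≈ : ∀ m s a b → shapeVal m s a ≡ shapeVal m s b → a ≈[ m ] b × s ∸ a ≈[ m ] s ∸ b
shapeVal⇒≈ m s a b e with shapeView m s a | shapeView m s b
... | middle m≤a a≤ _ | middle m≤b b≤ _ =
  inj₂ (m≤a , m≤b) , inj₂ (middle-complement m s a m≤a a≤ , middle-complement m s b m≤b b≤)
... | middle _ _ ea | exact eb = ⊥-elim (nothing≢just (trans (sym ea) (trans e eb)))
... | exact ea | middle _ _ eb = ⊥-elim (nothing≢just (trans (sym eb) (trans (sym e) ea)))
... | exact ea | exact eb with just-injective (trans (sym ea) (trans e eb))
...   | refl = inj₁ refl , inj₁ refl

shapeVal-between : ∀ m s a b x → shapeVal m s a ≡ shapeVal m s b → a ≤ x → x ≤ b → shapeVal m s x ≡ shapeVal m s a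
shapeVal-between m s a b x e a≤x x≤b with shapeView m s a | shapeView m s b
... | middle m≤a _ ea | middle _ b≤ _ = trans (shapeVal-middle m s x (≤-trans m≤a a≤x) (≤-trans x≤b b≤)) (sym ea)
... | middle _ _ ea | exact eb = ⊥-elim (nothing≢just (trans (sym ea) (trans e eb)))
... | exact ea | middle _ _ eb = ⊥-elim (nothing≢just (trans (sym eb) (trans (sym e) ea)))
... | exact ea | exact eb with just-injective (trans (sym ea) (trans e eb))
...   | refl = cong (shapeVal m s) (≤-antisym x≤b a≤x)

module _ {n c} (G : ColoredGraph n c) where

  classSize : Fin n → ℕ
  classSize v = count (sameType G v)

  classCount : Fin n → Subset n → ℕ
  classCount v X = count (λ i → sameType G v i ∧ lookup X i)

  shapeAt≡shapeVal : ∀ m v X → shapeAt m (typeClass G v) X ≡ shapeVal m (classSize v) (classCount v X)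
  shapeAt≡shapeVal m v X = cong₂ (shapeVal m)
    (trans (∣p∣≡count (typeClass G v)) (count-cong _ _ (lookup∘tabulate (sameType G v))))
    (trans (∣p∣≡count (typeClass G v ∩ X)) (count-cong _ _ λ i →
      trans (lookup-zipWith _∧_ i (typeClass G v) X) (cong (_∧ lookup X i) (lookup∘tabulate (sameType G v) i))))

  sameShape⇒shapeVal : ∀ m X Y → SameShape G m X Y → ∀ v →
    shapeVal m (classSize v) (classCount v X) ≡ shapeVal m (classSize v) (classCount v Y)
  sameShape⇒shapeVal m X Y sh v = trans (sym (shapeAt≡shapeVal m v X)) (trans (sh v) (shapeAt≡shapeVal m v Y))

  cellSize-sets : ∀ X t (p : Fin 1 → Bool) →
    cellSize G noVars (λ _ → X) t p ≡ count (λ i → sameType G t i ∧ (p zero == lookup X i))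
  cellSize-sets X t p = count-cong _ _ (λ i → cong (sameType G t i ∧_) (∧-identityʳ _))

  sameShape⇒similar : ∀ m X Y → SameShape G m X Y → Similar G m noVars noVars (λ _ → X) (λ _ → Y)
  sameShape⇒similar m X Y sh = record
    { equal⇒equal = λ ()
    ; equal⇐equal = λ ()
    ; sameTypes   = λ ()
    ; sameMembers = λ ()
    ; cellSizes   = cells }
    where
    cells : ∀ t p → cellSize G noVars (λ _ → X) t p ≈[ m ] cellSize G noVars (λ _ → Y) t p
    cells t p rewrite cellSize-sets X t p | cellSize-sets Y t p with p zero
    ... | true  rewrite count-∧-true== (sameType G t) (lookup X) | count-∧-true== (sameType G t) (lookup Y) =
      proj₁ (shapeVal⇒≈ m (classSize t) (classCount t X) (classCount t Y) (sameShape⇒shapeVal m X Y sh t))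
    ... | false rewrite count-∧-false== (sameType G t) (lookup X) | count-∧-false== (sameType G t) (lookup Y) =
      proj₂ (shapeVal⇒≈ m (classSize t) (classCount t X) (classCount t Y) (sameShape⇒shapeVal m X Y sh t))

  sameShape⇒feasible : ∀ φ X Y → SameShape G (q φ) X Y → Feasible G φ X → Feasible G φ Y
  sameShape⇒feasible φ X Y sh = similar⇒⟦⟧ G φ (sameShape⇒similar (q φ) X Y sh) ≤-refl

-- Token jumping between sets of the same shape

lookup-─ : ∀ {n} (X Y : Subset n) i → lookup (X ─ Y) i ≡ lookup X i ∧ not (lookup Y i)
lookup-─ (x ∷ X) (true  ∷ Y) zero    = sym (∧-zeroʳ x)
lookup-─ (x ∷ X) (false ∷ Y) zero    = sym (∧-identityʳ x)
lookup-─ (x ∷ X) (y     ∷ Y) (suc i) = lookup-─ X Y i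

∣─∣≡count : ∀ {n} (X Y : Subset n) → ∣ X ─ Y ∣ ≡ count (λ i → lookup X i ∧ not (lookup Y i))
∣─∣≡count X Y = trans (∣p∣≡count (X ─ Y)) (count-cong _ _ (lookup-─ X Y))

lookup-ext : ∀ {n} (X Y : Subset n) → (∀ i → lookup X i ≡ lookup Y i) → X ≡ Y
lookup-ext X Y X≗Y = trans (sym (tabulate∘lookup X)) (trans (tabulate-cong X≗Y) (tabulate∘lookup Y))

module _ {n c} {G : ColoredGraph n c} {φ : Formula c 0 1} where

  TJSeq-refl : ∀ {A} → Feasible G φ A → TJSeq G φ A A 0
  TJSeq-refl {A} fA = record
    { S = λ _ → A ; start = refl ; end = refl ; out = λ () ; inn = λ () ; feasible = λ _ → fA }

  TJSeq-cons : ∀ {A B C ℓ} → Feasible G φ A → ∣ A ─ B ∣ ≡ 1 → ∣ B ─ A ∣ ≡ 1 →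
    TJSeq G φ B C ℓ → TJSeq G φ A C (suc ℓ)
  TJSeq-cons {A} {B} {C} {ℓ} fA out₀ inn₀ σ = record
    { S = S' ; start = refl ; end = end σ ; out = out' ; inn = inn' ; feasible = feasible' }
    where
    S' : Fin (suc (suc ℓ)) → Subset _
    S' zero    = A
    S' (suc i) = S σ i
    out' : ∀ i → ∣ S' (inject₁ i) ─ S' (suc i) ∣ ≡ 1
    out' zero    = subst (λ Z → ∣ A ─ Z ∣ ≡ 1) (sym (start σ)) out₀
    out' (suc i) = out σ i
    inn' : ∀ i → ∣ S' (suc i) ─ S' (inject₁ i) ∣ ≡ 1
    inn' zero    = subst (λ Z → ∣ Z ─ A ∣ ≡ 1) (sym (start σ)) inn₀
    inn' (suc i) = inn σ i
    feasible' : ∀ i → Feasible G φ (S' i)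
    feasible' zero    = fA
    feasible' (suc i) = feasible σ i

module _ {n c} (G : ColoredGraph n c) (target : Subset n) where

  excess missing : Subset n → Fin n → Bool
  excess  C i = lookup C i ∧ not (lookup target i)
  missing C i = lookup target i ∧ not (lookup C i)

  count-excess≡count-missing : ∀ C → count (lookup C) ≡ count (lookup target) →
    count (excess C) ≡ count (missing C)
  count-excess≡count-missing C e = +-cancelˡ-≡ (count common) _ _ (begin
    count common + count (excess C)                                 ≡⟨ sym (count-split (lookup C) (lookup target)) ⟩
    count (lookup C)                                                ≡⟨ e ⟩
    count (lookup target)                                           ≡⟨ count-split (lookup target) (lookup C) ⟩
    count (λ i → lookup target i ∧ lookup C i) + count (missing C)  ≡⟨ cong (_+ count (missing C)) (count-cong _ _
                                                                         (λ i → ∧-comm (lookup target i) (lookup C i))) ⟩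
    count common + count (missing C)                                ∎)
    where
    open ≡-Reasoning
    common : Fin n → Bool
    common i = lookup C i ∧ lookup target i

  no-excess⇒≡ : ∀ C → count (excess C) ≡ 0 → count (lookup C) ≡ count (lookup target) → C ≡ target
  no-excess⇒≡ C e sizes = lookup-ext C target λ i →
    both (lookup C i) (lookup target i) (count≡0 _ e i) (count≡0 _ no-missing i)
    where
    no-missing : count (missing C) ≡ 0
    no-missing = trans (sym (count-excess≡count-missing C sizes)) e
    both : ∀ a b → a ∧ not b ≡ false → b ∧ not a ≡ false → a ≡ b
    both true  true  _ _ = refl
    both false false _ _ = refl

  NoSameTypePair : Subset n → Set
  NoSameTypePair C = ∀ u w → excess C u ≡ true → missing C w ≡ true → SameType G u w → ⊥

  exchange : Subset n → Fin n → Fin n → Subset n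
  exchange C u w = tabulate λ i → (lookup C i ∧ not (u ==ᶠ i)) ∨ (w ==ᶠ i)

  module Exchange (C : Subset n) (u w : Fin n) (u-excess : excess C u ≡ true) (w-missing : missing C w ≡ true) where

    C' : Subset n
    C' = exchange C u w

    u∈C : lookup C u ≡ true
    u∈C = ∧-conicalˡ _ _ u-excess
    u∉target : lookup target u ≡ false
    u∉target = not-injective (∧-conicalʳ _ _ u-excess)
    w∈target : lookup target w ≡ true
    w∈target = ∧-conicalˡ _ _ w-missing
    w∉C : lookup C w ≡ false
    w∉C = not-injective (∧-conicalʳ _ _ w-missing)

    w≢u : w ≢ u
    w≢u refl = true≢false (trans (sym u∈C) w∉C)

    lookup-C' : ∀ i → lookup C' i ≡ (lookup C i ∧ not (u ==ᶠ i)) ∨ (w ==ᶠ i)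
    lookup-C' = lookup∘tabulate _

    removed : ∀ i → lookup C i ∧ not (lookup C' i) ≡ (u ==ᶠ i)
    removed i rewrite lookup-C' i with u ≟ i
    ... | yes refl rewrite u∈C | ==ᶠ-≢ w≢u = refl
    ... | no _ with lookup C i
    ...   | true  = refl
    ...   | false = refl

    added : ∀ i → lookup C' i ∧ not (lookup C i) ≡ (w ==ᶠ i)
    added i rewrite lookup-C' i with w ≟ i
    ... | yes refl rewrite w∉C = refl
    ... | no _ with lookup C i | u ==ᶠ i
    ...   | true  | true  = refl
    ...   | true  | false = refl
    ...   | false | _     = refl

    excess-after : ∀ i → excess C' i ≡ excess C i ∧ not (u ==ᶠ i)
    excess-after i rewrite lookup-C' i with w ≟ i
    ... | yes refl rewrite w∈target | w∉C = refl
    ... | no _ with lookup C i | u ==ᶠ i | lookup target i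
    ...   | true  | true  | t = sym (∧-zeroʳ (not t))
    ...   | true  | false | true  = refl
    ...   | true  | false | false = refl
    ...   | false | _     | _     = refl

    kept : ∀ i → lookup C' i ∧ not (w ==ᶠ i) ≡ lookup C i ∧ not (u ==ᶠ i)
    kept i rewrite lookup-C' i with w ≟ i
    ... | yes refl rewrite w∉C = refl
    ... | no _ with lookup C i | u ==ᶠ i
    ...   | true  | true  = refl
    ...   | true  | false = refl
    ...   | false | _     = refl

    w∈C' : lookup C' w ≡ true
    w∈C' rewrite lookup-C' w | ==ᶠ-refl w with lookup C w ∧ not (u ==ᶠ w)
    ... | true  = refl
    ... | false = refl

    ∣C─C'∣≡1 : ∣ C ─ C' ∣ ≡ 1
    ∣C─C'∣≡1 = trans (∣─∣≡count C C') (trans (count-cong _ _ removed) (count-singleton u))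

    ∣C'─C∣≡1 : ∣ C' ─ C ∣ ≡ 1
    ∣C'─C∣≡1 = trans (∣─∣≡count C' C) (trans (count-cong _ _ added) (count-singleton w))

    count-excess-after : count (excess C) ≡ suc (count (excess C'))
    count-excess-after = trans (count-remove (excess C) u u-excess) (cong suc (sym (count-cong _ _ excess-after)))

    size-after : count (lookup C') ≡ count (lookup C)
    size-after = begin
      count (lookup C')                             ≡⟨ count-remove (lookup C') w w∈C' ⟩
      suc (count (λ i → lookup C' i ∧ not (w ==ᶠ i))) ≡⟨ cong suc (count-cong _ _ kept) ⟩
      suc (count (λ i → lookup C i ∧ not (u ==ᶠ i)))  ≡⟨ sym (count-remove (lookup C) u u∈C) ⟩
      count (lookup C)                              ∎
      where open ≡-Reasoning

    others : Fin n → ℕ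
    others v = count (λ i → (sameType G v i ∧ lookup C i) ∧ not (u ==ᶠ i))

    classCount-before : ∀ v {b} → sameType G v u ≡ b → classCount G v C ≡ fromBool b + others v
    classCount-before v {b} vu = trans (count-pick _ u)
      (cong (λ x → fromBool x + others v) (trans (cong (sameType G v u ∧_) u∈C) (trans (∧-identityʳ _) vu)))

    classCount-after : ∀ v {b} → sameType G v w ≡ b → classCount G v C' ≡ fromBool b + others v
    classCount-after v {b} vw = trans (count-pick _ w) (cong₂ (λ x r → fromBool x + r)
      (trans (cong (sameType G v w ∧_) w∈C') (trans (∧-identityʳ _) vw))
      (count-cong _ _ λ i → trans (∧-assoc (sameType G v i) (lookup C' i) (not (w ==ᶠ i)))
        (trans (cong (sameType G v i ∧_) (kept i)) (sym (∧-assoc (sameType G v i) (lookup C i) (not (u ==ᶠ i)))))))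

    target⊆after : NoSameTypePair C → ∀ v → SameType G v u → classCount G v target ≤ classCount G v C'
    target⊆after noPair v vu = count-mono _ _ λ i vi∧i∈target → cong₂ _∧_ (∧-conicalˡ _ _ vi∧i∈target)
      (i∈C' i (∧-conicalˡ _ _ vi∧i∈target) (∧-conicalʳ _ _ vi∧i∈target))
      where
      i∈C' : ∀ i → SameType G v i → lookup target i ≡ true → lookup C' i ≡ true
      i∈C' i vi i∈target with lookup C i in i∈C
      ... | false = ⊥-elim (noPair u i u-excess (cong₂ _∧_ i∈target (cong not i∈C))
                                   (sameType-trans G u v i (sameType-sym G v u vu) vi))
      ... | true  = trans (lookup-C' i) (cong₂ (λ a b → (a ∧ not b) ∨ (w ==ᶠ i)) i∈C (==ᶠ-≢ u≢i))
        where
        u≢i : u ≢ i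
        u≢i refl = true≢false (trans (sym i∈target) u∉target)

    after⊆target : NoSameTypePair C → ∀ v → SameType G v w → classCount G v C' ≤ classCount G v target
    after⊆target noPair v vw = count-mono _ _ λ i vi∧i∈C' → cong₂ _∧_ (∧-conicalˡ _ _ vi∧i∈C')
      (i∈target i (∧-conicalˡ _ _ vi∧i∈C') (∧-conicalʳ _ _ vi∧i∈C'))
      where
      i∈target : ∀ i → SameType G v i → lookup C' i ≡ true → lookup target i ≡ true
      i∈target i vi i∈C' with w ≟ i
      ... | yes refl = w∈target
      ... | no w≢i with lookup target i in i∉target
      ...   | true  = refl
      ...   | false = ⊥-elim (noPair i w (cong₂ _∧_ i∈C (cong not i∉target)) w-missing
                                     (sameType-trans G i v w (sameType-sym G v i vi) vw))
        where
        i∈C : lookup C i ≡ true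
        i∈C = ∧-conicalˡ _ _ (trans (sym (kept i)) (cong₂ _∧_ i∈C' (cong not (==ᶠ-≢ w≢i))))

    exchange-sameShape : ∀ m → SameType G u w ⊎ NoSameTypePair C → SameShape G m C target → SameShape G m C' target
    exchange-sameShape m pair sh v = trans (shapeAt≡shapeVal G m v C')
      (trans (shape-after pair) (sym (shapeAt≡shapeVal G m v target)))
      where
      shape : Subset n → Maybe ℕ
      shape X = shapeVal m (classSize G v) (classCount G v X)
      before : shape C ≡ shape target
      before = sameShape⇒shapeVal G m C target sh v
      unchanged : ∀ {b} → sameType G v u ≡ b → sameType G v w ≡ b → shape C' ≡ shape target
      unchanged vu vw = trans (cong (shapeVal m (classSize G v))
        (trans (classCount-after v vw) (sym (classCount-before v vu)))) before
      by-types : NoSameTypePair C → ∀ a → sameType G v u ≡ a → ∀ b → sameType G v w ≡ b → shape C' ≡ shape target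
      by-types _ true  vu true  vw = unchanged vu vw
      by-types _ false vu false vw = unchanged vu vw
      by-types noPair true vu false vw =
        shapeVal-between m (classSize G v) (classCount G v target) (classCount G v C) (classCount G v C')
          (sym before) (target⊆after noPair v vu)
          (subst₂ _≤_ (sym (classCount-after v vw)) (sym (classCount-before v vu)) (n≤1+n (others v)))
      by-types noPair false vu true vw = trans
        (shapeVal-between m (classSize G v) (classCount G v C) (classCount G v target) (classCount G v C')
          before (subst₂ _≤_ (sym (classCount-before v vu)) (sym (classCount-after v vw)) (n≤1+n (others v)))
          (after⊆target noPair v vw))
        before
      shape-after : SameType G u w ⊎ NoSameTypePair C → shape C' ≡ shape target
      shape-after (inj₁ uw)     = unchanged refl (sym (sameType-congʳ G v u w uw))
      shape-after (inj₂ noPair) = by-types noPair (sameType G v u) refl (sameType G v w) refl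

  exchangePair : ∀ C → 1 ≤ count (excess C) → count (excess C) ≡ count (missing C) →
    Σ (Fin n) λ u → Σ (Fin n) λ w → excess C u ≡ true × missing C w ≡ true × (SameType G u w ⊎ NoSameTypePair C)
  exchangePair C pos sizes with anyB (λ u → anyB (λ w → (excess C u ∧ missing C w) ∧ sameType G u w)) in found
  ... | true with anyB⇒ _ found
  ...   | u , u-found with anyB⇒ _ u-found
  ...     | w , uw = u , w , ∧-conicalˡ (excess C u) _ pair , ∧-conicalʳ (excess C u) _ pair ,
                     inj₁ (∧-conicalʳ (excess C u ∧ missing C w) _ uw)
    where
    pair : excess C u ∧ missing C w ≡ true
    pair = ∧-conicalˡ (excess C u ∧ missing C w) _ uw
  exchangePair C pos sizes | false =
    let u , u-excess  = count-witness (excess C) pos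
        w , w-missing = count-witness (missing C) (subst (1 ≤_) sizes pos)
    in u , w , u-excess , w-missing , inj₂ noPair
    where
    noPair : NoSameTypePair C
    noPair u' w' u'-excess w'-missing u'w' =
      true≢false (trans (cong₂ _∧_ (cong₂ _∧_ (sym u'-excess) (sym w'-missing)) (sym u'w'))
                        (anyB-false _ (anyB-false _ found u') w'))

  module _ (φ : Formula c 0 1) (target-feasible : Feasible G φ target) where

    sameShape⇒TJSeq : ∀ ℓ C → count (excess C) ≡ ℓ → count (lookup C) ≡ count (lookup target) →
      SameShape G (q φ) C target → Σ (TJSeq G φ C target ℓ) (λ σ → ∀ i → SameShape G (q φ) (S σ i) target)
    sameShape⇒TJSeq zero C e sizes sh with no-excess⇒≡ C e sizes
    ... | refl = TJSeq-refl target-feasible , λ _ → sh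
    sameShape⇒TJSeq (suc ℓ) C e sizes sh
      with exchangePair C (subst (1 ≤_) (sym e) (s≤s z≤n)) (count-excess≡count-missing C sizes)
    ... | u , w , u-excess , w-missing , pair =
      TJSeq-cons C-feasible ∣C─C'∣≡1 ∣C'─C∣≡1 (proj₁ tail) , shapes
      where
      open Exchange C u w u-excess w-missing
      C-feasible : Feasible G φ C
      C-feasible = sameShape⇒feasible G φ target C (λ v → sym (sh v)) target-feasible
      tail : Σ (TJSeq G φ C' target ℓ) (λ σ → ∀ i → SameShape G (q φ) (S σ i) target)
      tail = sameShape⇒TJSeq ℓ C' (suc-injective (trans (sym count-excess-after) e)) (trans size-after sizes)
                       (exchange-sameShape (q φ) pair sh)
      shapes : ∀ i → SameShape G (q φ) (S (TJSeq-cons C-feasible ∣C─C'∣≡1 ∣C'─C∣≡1 (proj₁ tail)) i) target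
      shapes zero    = sh
      shapes (suc i) = proj₂ tail i

lemma3p5 : ∀ {n c} (φ : Formula c 0 1) (G : ColoredGraph n c) (S S' : Subset n) (k : ℕ) →
    Feasible G φ S → Feasible G φ S' → ∣ S ∣ ≡ k → ∣ S' ∣ ≡ k →
    Σ (Fin c) (λ i → color G i ≡ S) → Σ (Fin c) (λ j → color G j ≡ S') →
    (R R' : Subset n) → Feasible G φ R → Feasible G φ R' →
    SameShape G (q φ) R R' → ∣ R ∣ ≡ ∣ R' ∣ →
    Σ (TJSeq G φ R R' ∣ R ─ R' ∣) (λ σ → ∀ i → SameShape G (q φ) (TJSeq.S σ i) R)
lemma3p5 φ G _ _ _ _ _ _ _ _ _ R R' _ R'-feasible sh sizes
  with sameShape⇒TJSeq G R' φ R'-feasible ∣ R ─ R' ∣ R (sym (∣─∣≡count R R'))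
         (trans (sym (∣p∣≡count R)) (trans sizes (∣p∣≡count R'))) sh
... | σ , shapes = σ , λ i v → trans (shapes i v) (sym (sh v))
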